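{- Let $\Gamma = (V_\Gamma, E_\Gamma)$ be a planarizing gadget for the class of $(2,0)$-tight graphs, with distinguished vertices $a,b,c,d$. Then for every subset $S \subseteq V_\Gamma$ with $|\{a,b\} \cap S| = 1$ and $|\{c,d\} \cap S| = 1$, we have $|E_\Gamma[S]| \leq 2|S| - 4$.
   Context: Graphs may be multigraphs. For a graph $G=(V,E)$ and $S \subseteq V$, $E[S]$ denotes the set of edges with both endpoints in $S$. A graph $G=(V,E)$ with $|V|=n$, $|E|=m$ is $(k,l)$-sparse if every $S \subseteq V$ with $|S| \geq 2$ satisfies $|E[S]| \leq k|S|-l$, and $(k,l)$-tight if it is $(k,l)$-sparse and $m = kn-l$. Given a graph $G$ with a drawing in the plane in which edges $ab$ and $cd$ cross, and a graph $\Gamma$ containing distinct vertices $a,b,c,d$, the graph $G' = G - \{ab,cd\} + \Gamma$ is obtained by deleting the edges $ab$ and $cd$ from $G$ and adding a copy of $\Gamma$ whose vertices $a,b,c,d$ are identified with the vertices $a,b,c,d$ of $G$ (all other vertices and edges of $\Gamma$ being new). A graph $\Gamma$ of constant size with distinct vertices $a,b,c,d$ and a planar embedding in which $a,c,b,d$ appear on the outer face in this order is a planarizing gadget for the class of $(2,0)$-tight graphs if for every graph $G$ and every drawing of $G$ with crossing edges $ab, cd$, $G$ is $(2,0)$-tight if and only if $G'$ is $(2,0)$-tight. -}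

module Defs where

open import Data.Nat using (ℕ; zero; suc; _+_; _*_; _≤_)
open import Data.Bool using (Bool; true; false; _∧_; _∨_; not; if_then_else_)
open import Data.Fin using (Fin; _≟_)
open import Data.List using (List; []; _∷_; _++_; map; length; filterᵇ; allFin)
open import Data.Product using (_×_; _,_)
open import Data.Sum using (_⊎_; inj₁; inj₂)
open import Relation.Nullary using (¬_)
open import Relation.Nullary.Decidable using (⌊_⌋)
open import Relation.Binary.PropositionalEquality using (_≡_)

-- A multigraph is given by a duplicate-free list of its vertices (of some
-- vertex type V) and a list of edges (a multiset of unordered pairs, each
-- stored as an ordered pair in arbitrary orientation; loops allowed).

countᵇ : {A : Set} → (A → Bool) → List A → ℕ
countᵇ p []       = 0
countᵇ p (x ∷ xs) = if p x then suc (countᵇ p xs) else countᵇ p xs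

card : {V : Set} → List V → (V → Bool) → ℕ
card vs S = countᵇ S vs

induced : {V : Set} → List (V × V) → (V → Bool) → ℕ
induced es S = countᵇ (λ { (u , v) → S u ∧ S v }) es

Sparse20 : {V : Set} → List V → List (V × V) → Set
Sparse20 vs es = (S : _ → Bool) → 2 ≤ card vs S → induced es S ≤ 2 * card vs S

Tight20 : {V : Set} → List V → List (V × V) → Set
Tight20 vs es = Sparse20 vs es × (length es ≡ 2 * length vs)

Distinct4 : {n : ℕ} → Fin n → Fin n → Fin n → Fin n → Set
Distinct4 a b c d =
  ¬ a ≡ b × ¬ a ≡ c × ¬ a ≡ d × ¬ b ≡ c × ¬ b ≡ d × ¬ c ≡ d

-- The replacement G' = G - {ab, cd} + Γ.
-- Γ has vertex set Fin k, edge list EΓ and distinguished vertices a b c d.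
-- G has vertex set Fin n, distinguished vertices ga gb gc gd and edge list
-- (ga , gb) ∷ (gc , gd) ∷ rest  (the edges ab and cd listed first).

module Glue {n k : ℕ} (a b c d : Fin k) (ga gb gc gd : Fin n) where

  isDist : Fin k → Bool
  isDist v = ⌊ v ≟ a ⌋ ∨ ⌊ v ≟ b ⌋ ∨ ⌊ v ≟ c ⌋ ∨ ⌊ v ≟ d ⌋

  φ : Fin k → Fin n ⊎ Fin k
  φ v = if ⌊ v ≟ a ⌋ then inj₁ ga else
        if ⌊ v ≟ b ⌋ then inj₁ gb else
        if ⌊ v ≟ c ⌋ then inj₁ gc else
        if ⌊ v ≟ d ⌋ then inj₁ gd else inj₂ v

  vertsG' : List (Fin n ⊎ Fin k)
  vertsG' = map inj₁ (allFin n) ++ map inj₂ (filterᵇ (λ v → not (isDist v)) (allFin k))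

  edgesG' : List (Fin n × Fin n) → List (Fin k × Fin k) → List ((Fin n ⊎ Fin k) × (Fin n ⊎ Fin k))
  edgesG' rest EΓ = map (λ { (u , v) → (inj₁ u , inj₁ v) }) rest
                 ++ map (λ { (u , v) → (φ u , φ v) }) EΓ

-- For every graph G containing two edges ab, cd on four distinct vertices
-- (equivalently: every graph with a drawing in which ab and cd cross),
-- G is (2,0)-tight iff G' is (2,0)-tight.

IsPlanarizingGadget20 : (k : ℕ) → List (Fin k × Fin k) → (a b c d : Fin k) → Set
IsPlanarizingGadget20 k EΓ a b c d =
  Distinct4 a b c d ×
  ((n : ℕ) (ga gb gc gd : Fin n) → Distinct4 ga gb gc gd →
   (rest : List (Fin n × Fin n)) →
   let open Glue a b c d ga gb gc gd in
   (Tight20 (allFin n) ((ga , gb) ∷ (gc , gd) ∷ rest) → Tight20 vertsG' (edgesG' rest EΓ)) ×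
   (Tight20 vertsG' (edgesG' rest EΓ) → Tight20 (allFin n) ((ga , gb) ∷ (gc , gd) ∷ rest)))

{-# OPTIONS --safe #-}
module Submission where

open import Defs
open import Data.Nat using (ℕ; _+_; _*_; _≤_; _≤?_; suc; s≤s; z≤n)
open import Data.Nat.Properties
  using (≤-refl; ≤-reflexive; ≤-trans; n≤1+n; m≤m+n; +-suc; +-comm; +-monoˡ-≤; *-monoʳ-≤;
         module ≤-Reasoning)
open import Data.Bool using (Bool; true; false; _xor_; _∧_; not; if_then_else_)
open import Data.Empty using (⊥-elim)
open import Data.Fin using (Fin; zero; suc; _≟_; #_)
open import Data.Fin.Subset using (Subset)
open import Data.Fin.Subset.Properties using (anySubset?)
open import Data.List using (List; []; _∷_; _++_; map; filterᵇ; allFin)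
open import Data.List.Membership.Propositional using (_∈_)
open import Data.List.Membership.Propositional.Properties using (∈-allFin)
open import Data.List.Relation.Unary.Any using (here; there)
open import Data.Product using (_×_; _,_; proj₁; proj₂; ∃-syntax)
open import Data.Sum using (_⊎_; inj₁; inj₂; [_,_]; map₂)
open import Data.Vec using (lookup; tabulate)
open import Data.Vec.Properties using (lookup∘tabulate)
open import Function using (_∘_)
open import Level using (Level)
open import Relation.Nullary using (Dec; yes; no)
open import Relation.Nullary.Decidable using (map′; ¬?; _→-dec_; decidable-stable; from-yes)
open import Relation.Unary using (Pred; Decidable)
open import Relation.Binary.PropositionalEquality
  using (_≡_; _≢_; _≗_; refl; sym; trans; cong; cong₂; subst₂)

-- Glue Γ into a (2,0)-tight host graph on four vertices 0, 1, 2, 3 in which the ends of ab and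
-- cd lying in S sit at 0 and 1, the other two ends at 2 and 3, and the remaining edges are four
-- copies of 01 and two copies of 23. The glued graph G' is (2,0)-tight because Γ is a gadget.
-- In G' the set S' = {0, 1} ∪ (S ∖ {a, b, c, d}) has |S'| = |S| and spans 4 + |E_Γ[S]| edges,
-- so (2,0)-sparsity of G' gives 4 + |E_Γ[S]| ≤ 2|S|.

module _ {A : Set} where

  countᵇ-++ : (p : A → Bool) (xs ys : List A) → countᵇ p (xs ++ ys) ≡ countᵇ p xs + countᵇ p ys
  countᵇ-++ p []       ys = refl
  countᵇ-++ p (x ∷ xs) ys with p x
  ... | true  = cong suc (countᵇ-++ p xs ys)
  ... | false = countᵇ-++ p xs ys

  countᵇ-map : {B : Set} (p : B → Bool) (f : A → B) (xs : List A) →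
               countᵇ p (map f xs) ≡ countᵇ (p ∘ f) xs
  countᵇ-map p f []       = refl
  countᵇ-map p f (x ∷ xs) with p (f x)
  ... | true  = cong suc (countᵇ-map p f xs)
  ... | false = countᵇ-map p f xs

  countᵇ-cong : {p q : A → Bool} → p ≗ q → (xs : List A) → countᵇ p xs ≡ countᵇ q xs
  countᵇ-cong p≗q []       = refl
  countᵇ-cong {p} {q} p≗q (x ∷ xs) with p x | q x | p≗q x
  ... | true  | true  | refl = cong suc (countᵇ-cong p≗q xs)
  ... | false | false | refl = countᵇ-cong p≗q xs

  countᵇ-partition : (p q : A → Bool) (xs : List A) →
                     countᵇ (λ x → p x ∧ q x) xs + countᵇ p (filterᵇ (not ∘ q) xs) ≡ countᵇ p xs
  countᵇ-partition p q []       = refl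
  countᵇ-partition p q (x ∷ xs) with q x
  ... | true with p x
  ...   | true  = cong suc (countᵇ-partition p q xs)
  ...   | false = countᵇ-partition p q xs
  countᵇ-partition p q (x ∷ xs) | false with p x
  ...   | true  = trans (+-suc _ _) (cong suc (countᵇ-partition p q xs))
  ...   | false = countᵇ-partition p q xs

  countᵇ-≤-∷ : (p : A → Bool) (y : A) (xs : List A) → countᵇ p xs ≤ countᵇ p (y ∷ xs)
  countᵇ-≤-∷ p y xs with p y
  ... | true  = n≤1+n _
  ... | false = ≤-refl

  1≤countᵇ : {p : A → Bool} {x : A} {xs : List A} → x ∈ xs → p x ≡ true → 1 ≤ countᵇ p xs
  1≤countᵇ {p} {xs = y ∷ ys} (here refl)  px rewrite px = s≤s z≤n
  1≤countᵇ {p} {xs = y ∷ ys} (there x∈ys) px = ≤-trans (1≤countᵇ x∈ys px) (countᵇ-≤-∷ p y ys)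

  2≤countᵇ : {p : A → Bool} {x y : A} {xs : List A} → x ≢ y → x ∈ xs → y ∈ xs →
             p x ≡ true → p y ≡ true → 2 ≤ countᵇ p xs
  2≤countᵇ x≢y (here refl)  (here refl)  px py = ⊥-elim (x≢y refl)
  2≤countᵇ x≢y (here refl)  (there y∈zs) px py rewrite px = s≤s (1≤countᵇ y∈zs py)
  2≤countᵇ x≢y (there x∈zs) (here refl)  px py rewrite py = s≤s (1≤countᵇ x∈zs px)
  2≤countᵇ {p} {xs = z ∷ zs} x≢y (there x∈zs) (there y∈zs) px py =
    ≤-trans (2≤countᵇ x≢y x∈zs y∈zs px py) (countᵇ-≤-∷ p z zs)

xor-witness : {A : Set} (S : A → Bool) (x y : A) → S x xor S y ≡ true →
              ∃[ z ] (z ≡ x ⊎ z ≡ y) × S z ≡ true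
xor-witness S x y x⊕y with S x in Sx
... | true  = x , inj₁ refl , Sx
... | false = y , inj₂ refl , x⊕y

induced-cong : {V : Set} (es : List (V × V)) {S T : V → Bool} → S ≗ T → induced es S ≡ induced es T
induced-cong es S≗T = countᵇ-cong (λ e → cong₂ _∧_ (S≗T (proj₁ e)) (S≗T (proj₂ e))) es

SparseAt : {V : Set} → List V → List (V × V) → (V → Bool) → Set
SparseAt vs es S = 2 ≤ card vs S → induced es S ≤ 2 * card vs S

SparseAt-resp-≗ : {V : Set} (vs : List V) (es : List (V × V)) {S T : V → Bool} →
                  S ≗ T → SparseAt vs es S → SparseAt vs es T
SparseAt-resp-≗ vs es S≗T =
  subst₂ (λ i c → 2 ≤ c → i ≤ 2 * c) (induced-cong es S≗T) (countᵇ-cong S≗T vs)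

all-subsets? : {n : ℕ} {ℓ : Level} {P : Pred (Subset n) ℓ} → Decidable P → Dec (∀ p → P p)
all-subsets? P? = map′ (λ ¬∃¬P p → decidable-stable (P? p) (λ ¬Pp → ¬∃¬P (p , ¬Pp)))
                       (λ ∀P (p , ¬Pp) → ¬Pp (∀P p))
                       (¬? (anySubset? (¬? ∘ P?)))

sparse20? : {n : ℕ} (vs : List (Fin n)) (es : List (Fin n × Fin n)) → Dec (Sparse20 vs es)
sparse20? vs es =
  map′ (λ sparse S → SparseAt-resp-≗ vs es (lookup∘tabulate S) (sparse (tabulate S)))
       (λ sparse p → sparse (lookup p))
       (all-subsets? λ p → 2 ≤? card vs (lookup p) →-dec induced es (lookup p) ≤? 2 * card vs (lookup p))

module GlueProperties {n k : ℕ} (a b c d : Fin k) (ga gb gc gd : Fin n) where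
  open Glue a b c d ga gb gc gd public

  nonDistinguished : List (Fin k)
  nonDistinguished = filterᵇ (not ∘ isDist) (allFin k)

  card-vertsG' : (T : Fin n ⊎ Fin k → Bool) →
                 card vertsG' T ≡ card (allFin n) (T ∘ inj₁) + countᵇ (T ∘ inj₂) nonDistinguished
  card-vertsG' T =
    trans (countᵇ-++ T (map inj₁ (allFin n)) (map inj₂ nonDistinguished))
          (cong₂ _+_ (countᵇ-map T inj₁ (allFin n)) (countᵇ-map T inj₂ nonDistinguished))

  induced-edgesG' : (rest : List (Fin n × Fin n)) (EΓ : List (Fin k × Fin k)) (T : Fin n ⊎ Fin k → Bool) →
                    induced (edgesG' rest EΓ) T ≡ induced rest (T ∘ inj₁) + induced EΓ (T ∘ φ)
  induced-edgesG' rest EΓ T =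
    trans (countᵇ-++ bothIn (map fromHost rest) (map fromGadget EΓ))
          (cong₂ _+_ (countᵇ-map bothIn fromHost rest) (countᵇ-map bothIn fromGadget EΓ))
    where
      bothIn : (Fin n ⊎ Fin k) × (Fin n ⊎ Fin k) → Bool
      bothIn (u , v) = T u ∧ T v
      fromHost : Fin n × Fin n → (Fin n ⊎ Fin k) × (Fin n ⊎ Fin k)
      fromHost (u , v) = inj₁ u , inj₁ v
      fromGadget : Fin k × Fin k → (Fin n ⊎ Fin k) × (Fin n ⊎ Fin k)
      fromGadget (u , v) = φ u , φ v

  φ-agrees : {R : Fin n → Bool} {S : Fin k → Bool} →
             R ga ≡ S a → R gb ≡ S b → R gc ≡ S c → R gd ≡ S d → [ R , S ] ∘ φ ≗ S
  φ-agrees ea eb ec ed v with v ≟ a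
  ... | yes refl = ea
  ... | no _ with v ≟ b
  ...   | yes refl = eb
  ...   | no _ with v ≟ c
  ...     | yes refl = ec
  ...     | no _ with v ≟ d
  ...       | yes refl = ed
  ...       | no _     = refl

  isDist-distinguished : {v : Fin k} → v ≡ a ⊎ v ≡ b ⊎ v ≡ c ⊎ v ≡ d → isDist v ≡ true
  isDist-distinguished {v} v∈abcd with v ≟ a | v ≟ b | v ≟ c | v ≟ d
  ... | yes _  | _      | _      | _      = refl
  ... | no _   | yes _  | _      | _      = refl
  ... | no _   | no _   | yes _  | _      = refl
  ... | no _   | no _   | no _   | yes _  = refl
  ... | no v≢a | no v≢b | no v≢c | no v≢d = ⊥-elim ([ v≢a , [ v≢b , [ v≢c , v≢d ] ] ] v∈abcd)

  2≤countᵇ-distinguished : Distinct4 a b c d → (S : Fin k → Bool) →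
                           S a xor S b ≡ true → S c xor S d ≡ true →
                           2 ≤ countᵇ (λ v → S v ∧ isDist v) (allFin k)
  2≤countᵇ-distinguished (_ , a≢c , a≢d , b≢c , b≢d , _) S a⊕b c⊕d
    with xor-witness S a b a⊕b | xor-witness S c d c⊕d
  ... | x , x∈ab , Sx | y , y∈cd , Sy =
    2≤countᵇ (separated x∈ab y∈cd) (∈-allFin x) (∈-allFin y)
             (cong₂ _∧_ Sx (isDist-distinguished (map₂ inj₁ x∈ab)))
             (cong₂ _∧_ Sy (isDist-distinguished (inj₂ (inj₂ y∈cd))))
    where
      separated : {x y : Fin k} → x ≡ a ⊎ x ≡ b → y ≡ c ⊎ y ≡ d → x ≢ y
      separated (inj₁ refl) (inj₁ refl) = a≢c
      separated (inj₁ refl) (inj₂ refl) = a≢d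
      separated (inj₂ refl) (inj₁ refl) = b≢c
      separated (inj₂ refl) (inj₂ refl) = b≢d

  2+nonDistinguished≤card : Distinct4 a b c d → (S : Fin k → Bool) →
                            S a xor S b ≡ true → S c xor S d ≡ true →
                            2 + countᵇ S nonDistinguished ≤ card (allFin k) S
  2+nonDistinguished≤card distinct S a⊕b c⊕d = begin
    2 + countᵇ S nonDistinguished
      ≤⟨ +-monoˡ-≤ _ (2≤countᵇ-distinguished distinct S a⊕b c⊕d) ⟩
    countᵇ (λ v → S v ∧ isDist v) (allFin k) + countᵇ S nonDistinguished
      ≡⟨ countᵇ-partition S isDist (allFin k) ⟩
    card (allFin k) S ∎
    where open ≤-Reasoning

  glued-sparse⇒bound : (rest : List (Fin n × Fin n)) (EΓ : List (Fin k × Fin k)) →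
                       Sparse20 vertsG' (edgesG' rest EΓ) →
                       {R : Fin n → Bool} {S : Fin k → Bool} → [ R , S ] ∘ φ ≗ S → 2 ≤ card (allFin n) R →
                       induced rest R + induced EΓ S ≤ 2 * (card (allFin n) R + countᵇ S nonDistinguished)
  glued-sparse⇒bound rest EΓ sparse {R} {S} agree 2≤R = begin
    induced rest R + induced EΓ S
      ≡⟨ sym (trans (induced-edgesG' rest EΓ T) (cong (induced rest R +_) (induced-cong EΓ agree))) ⟩
    induced (edgesG' rest EΓ) T
      ≤⟨ sparse T 2≤T ⟩
    2 * card vertsG' T
      ≡⟨ cong (2 *_) (card-vertsG' T) ⟩
    2 * (card (allFin n) R + countᵇ S nonDistinguished) ∎
    where
      open ≤-Reasoning
      T : Fin n ⊎ Fin k → Bool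
      T = [ R , S ]
      2≤T : 2 ≤ card vertsG' T
      2≤T = ≤-trans 2≤R (≤-trans (m≤m+n _ _) (≤-reflexive (sym (card-vertsG' T))))

inside : Fin 4 → Bool
inside zero          = true
inside (suc zero)    = true
inside (suc (suc _)) = false

host-a host-b host-c host-d : Bool → Fin 4
host-a s = if s then # 0 else # 2
host-b s = if s then # 2 else # 0
host-c t = if t then # 1 else # 3
host-d t = if t then # 3 else # 1

host-rest : List (Fin 4 × Fin 4)
host-rest = (# 0 , # 1) ∷ (# 0 , # 1) ∷ (# 0 , # 1) ∷ (# 0 , # 1) ∷ (# 2 , # 3) ∷ (# 2 , # 3) ∷ []

host : Bool → Bool → List (Fin 4 × Fin 4)
host s t = (host-a s , host-b s) ∷ (host-c t , host-d t) ∷ host-rest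

host-distinct : ∀ s t → Distinct4 (host-a s) (host-b s) (host-c t) (host-d t)
host-distinct true  true  = (λ ()) , (λ ()) , (λ ()) , (λ ()) , (λ ()) , (λ ())
host-distinct true  false = (λ ()) , (λ ()) , (λ ()) , (λ ()) , (λ ()) , (λ ())
host-distinct false true  = (λ ()) , (λ ()) , (λ ()) , (λ ()) , (λ ()) , (λ ())
host-distinct false false = (λ ()) , (λ ()) , (λ ()) , (λ ()) , (λ ()) , (λ ())

host-tight : ∀ s t → Tight20 (allFin 4) (host s t)
host-tight true  true  = from-yes (sparse20? (allFin 4) (host true  true))  , refl
host-tight true  false = from-yes (sparse20? (allFin 4) (host true  false)) , refl
host-tight false true  = from-yes (sparse20? (allFin 4) (host false true))  , refl
host-tight false false = from-yes (sparse20? (allFin 4) (host false false)) , refl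

inside-host-a : ∀ s → inside (host-a s) ≡ s
inside-host-a true  = refl
inside-host-a false = refl

inside-host-b : ∀ {s s'} → s xor s' ≡ true → inside (host-b s) ≡ s'
inside-host-b {true}  {false} _ = refl
inside-host-b {false} {true}  _ = refl

inside-host-c : ∀ t → inside (host-c t) ≡ t
inside-host-c true  = refl
inside-host-c false = refl

inside-host-d : ∀ {t t'} → t xor t' ≡ true → inside (host-d t) ≡ t'
inside-host-d {true}  {false} _ = refl
inside-host-d {false} {true}  _ = refl

lemma5 : (k : ℕ) (EΓ : List (Fin k × Fin k)) (a b c d : Fin k) →
    IsPlanarizingGadget20 k EΓ a b c d →
    (S : Fin k → Bool) → (S a xor S b) ≡ true → (S c xor S d) ≡ true →
    induced EΓ S + 4 ≤ 2 * card (allFin k) S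
lemma5 k EΓ a b c d (distinct , gadget) S a⊕b c⊕d = begin
  induced EΓ S + 4                     ≡⟨ +-comm (induced EΓ S) 4 ⟩
  4 + induced EΓ S                     ≤⟨ glued-sparse⇒bound host-rest EΓ G'-sparse agree ≤-refl ⟩
  2 * (2 + countᵇ S nonDistinguished)  ≤⟨ *-monoʳ-≤ 2 (2+nonDistinguished≤card distinct S a⊕b c⊕d) ⟩
  2 * card (allFin k) S                ∎
  where
    open ≤-Reasoning
    open GlueProperties a b c d (host-a (S a)) (host-b (S a)) (host-c (S c)) (host-d (S c))
    G'-sparse : Sparse20 vertsG' (edgesG' host-rest EΓ)
    G'-sparse = proj₁ (proj₁ (gadget 4 _ _ _ _ (host-distinct (S a) (S c)) host-rest)
                             (host-tight (S a) (S c)))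
    agree : [ inside , S ] ∘ φ ≗ S
    agree = φ-agrees (inside-host-a (S a)) (inside-host-b a⊕b) (inside-host-c (S c)) (inside-host-d c⊕d)
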